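{- Let $n\ge1$, let $x=(x_1,\dots,x_{2n})$ be indeterminates and let $b$ be a nonzero parameter. Then $$A^{(2)}_{\mathrm{OO}}(4n;x;\zeta_4,b,b)=2^{ -2n^2+2n}\prod_{i=1}^{2n}x_i^{ -2n+1}\prod_{1\le i<j\le2n}(1+x_i^2x_j^2).$$
   Context: $\sigma(t)=t-t^{ -1}$, $\zeta_4=\sqrt{ -1}$. For parameters $a,b,c$ let $M_{\mathrm{OO}}(n;x;a,b,c)$ be the skew-symmetric $2n\times2n$ matrix with entries $\sigma(x_j/x_i)\Big(\dfrac{c^2}{\sigma(ax_ix_j)}+\dfrac{b^2}{\sigma(a/(x_ix_j))}\Big)$, let $F_{\mathrm{OD}}(n;x;a)=\dfrac{\prod_{1\le i<j\le2n}\sigma(ax_ix_j)\sigma(a/(x_ix_j))}{\prod_{1\le i<j\le2n}\sigma(x_j/x_i)}$, and $A^{(2)}_{\mathrm{OO}}(4n;x;a,b,c)=c^{ -2n}\sigma(a)^{ -2n^2+n}F_{\mathrm{OD}}(n;x;a)\operatorname{Pf}M_{\mathrm{OO}}(n;x;a,b,c)$, where $\operatorname{Pf}$ denotes the Pfaffian. -}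

module Defs where

open import Level using (_⊔_)
open import Algebra.Bundles using (CommutativeRing)
open import Data.Nat as ℕ using (ℕ; zero; suc)
open import Data.Integer as ℤ using (ℤ; +_; -[1+_])
open import Data.Fin as Fin using (Fin; toℕ)
open import Data.Vec as Vec using (Vec; []; _∷_; lookup; removeAt; allFin)
open import Relation.Nullary using (¬_; yes; no)

-- Everything is stated over a commutative ring R equipped with a function
-- inv that is a multiplicative inverse on nonzero elements (i.e. a field,
-- see the hypotheses of the theorem).
module _ {c ℓ} (R : CommutativeRing c ℓ) (inv : CommutativeRing.Carrier R → CommutativeRing.Carrier R) where
  open CommutativeRing R

  pow : Carrier → ℕ → Carrier
  pow x zero = 1#
  pow x (suc k) = x * pow x k

  powℤ : Carrier → ℤ → Carrier
  powℤ x (+ k) = pow x k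
  powℤ x -[1+ k ] = pow (inv x) (suc k)

  _÷_ : Carrier → Carrier → Carrier
  x ÷ y = x * inv y

  two : Carrier
  two = 1# + 1#

  σ : Carrier → Carrier
  σ t = t - inv t

  sumFin : (m : ℕ) → (Fin m → Carrier) → Carrier
  sumFin zero f = 0#
  sumFin (suc m) f = f Fin.zero + sumFin m (λ k → f (Fin.suc k))

  prodFin : (m : ℕ) → (Fin m → Carrier) → Carrier
  prodFin zero f = 1#
  prodFin (suc m) f = f Fin.zero * prodFin m (λ k → f (Fin.suc k))

  prodPairs : (m : ℕ) → (Fin m → Fin m → Carrier) → Carrier
  prodPairs m f = prodFin m (λ i → prodFin m (λ j → lt i j (toℕ i ℕ.<? toℕ j)))
    where
    lt : (i j : Fin m) → _ → Carrier
    lt i j (yes _) = f i j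
    lt i j (no _)  = 1#

  sgn : ℕ → Carrier
  sgn k = pow (- 1#) k

  -- Pfaffian of the submatrix of A indexed by the list of indices is
  -- (expansion along the first index):
  --   pf (i ∷ rest) = Σ_k (-1)^k A(i, rest_k) pf(rest without rest_k)
  pfAux : ∀ {m} (A : Fin m → Fin m → Carrier) (k : ℕ) → Vec (Fin m) k → Carrier
  pfAux A zero [] = 1#
  pfAux A (suc zero) (_ ∷ []) = 0#
  pfAux A (suc (suc k)) (i ∷ rest) =
    sumFin (suc k) (λ p → sgn (toℕ p) * (A i (lookup rest p) * pfAux A k (removeAt rest p)))

  -- Pfaffian of an m × m matrix (0 when m is odd)
  Pf : (m : ℕ) → (Fin m → Fin m → Carrier) → Carrier
  Pf m A = pfAux A m (allFin m)

  M-OO : (n : ℕ) → (Fin (2 ℕ.* n) → Carrier) → Carrier → Carrier → Carrier → Fin (2 ℕ.* n) → Fin (2 ℕ.* n) → Carrier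
  M-OO n x a b c i j =
    σ (x j ÷ x i) * ((c * c) ÷ σ (a * (x i * x j)) + (b * b) ÷ σ (a ÷ (x i * x j)))

  F-OD : (n : ℕ) → (Fin (2 ℕ.* n) → Carrier) → Carrier → Carrier
  F-OD n x a =
    prodPairs (2 ℕ.* n) (λ i j → σ (a * (x i * x j)) * σ (a ÷ (x i * x j)))
    ÷ prodPairs (2 ℕ.* n) (λ i j → σ (x j ÷ x i))

  A2-OO : (n : ℕ) → (Fin (2 ℕ.* n) → Carrier) → Carrier → Carrier → Carrier → Carrier
  A2-OO n x a b c =
    powℤ c (ℤ.- (+ (2 ℕ.* n)))
    * (powℤ (σ a) (ℤ.- (+ (2 ℕ.* n ℕ.* n)) ℤ.+ (+ n))
    * (F-OD n x a * Pf (2 ℕ.* n) (M-OO n x a b c)))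

  RHS : (n : ℕ) → (Fin (2 ℕ.* n) → Carrier) → Carrier
  RHS n x =
    powℤ two (ℤ.- (+ (2 ℕ.* n ℕ.* n)) ℤ.+ (+ (2 ℕ.* n)))
    * (prodFin (2 ℕ.* n) (λ i → powℤ (x i) (ℤ.- (+ (2 ℕ.* n)) ℤ.+ (+ 1)))
    * prodPairs (2 ℕ.* n) (λ i j → 1# + (x i * x i) * (x j * x j)))

{-# OPTIONS --safe #-}
-- Write uᵢ = xᵢ². Because σ (ζ y) = σ (ζ / y) = ζ (y + y⁻¹) and σ (xⱼ / xᵢ) = (uⱼ - uᵢ) / (xᵢ xⱼ), every
-- entry of M_OO(n; x; ζ, b, b) is K = -2ζb² times aᵢⱼ = (uⱼ - uᵢ) / (1 + uᵢ uⱼ), so by Schur's Pfaffian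
-- identity Pf (aᵢⱼ) = ∏_{i<j} aᵢⱼ the Pfaffian is Kⁿ ∏_{i<j} aᵢⱼ. Against F_OD each pair i < j then
-- contributes -(1 + uᵢ uⱼ) / (xᵢ xⱼ), and the scalar factors collapse to 2^(-2n²+2n).
-- Schur's identity is proved by expanding along the first row. With uᵢ = tan θᵢ one has
-- aᵢⱼ = tan (θⱼ - θᵢ); the partial fraction expansion of ∏_q tan (θ_q - φ) in tan φ has coefficients
-- ∏_{q ≠ p} cot (θ_p - θ_q), the reciprocals of the row products left after deleting p, so the
-- first-row expansion collapses to ∏_{i<j} aᵢⱼ.
module Submission where

open import Defs
open import Algebra.Bundles using (CommutativeRing)
import Algebra.Solver.Ring.AlmostCommutativeRing as ACR
open import Data.Empty using (⊥-elim)
open import Data.Fin as Fin using (Fin; toℕ)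
import Data.Fin.Properties as Fin
open import Data.Integer as ℤ using (ℤ; +_; -[1+_])
import Data.Integer.Properties as ℤ
open import Data.Maybe using (Maybe; just; nothing)
open import Data.Nat as ℕ using (ℕ; zero; suc; s≤s; z≤n)
import Data.Nat.Properties as ℕ
open import Data.Product using (_×_; _,_; proj₁; proj₂)
open import Data.Sign as Sign using (Sign)
open import Data.Vec using (Vec; []; _∷_; lookup; removeAt; allFin; tabulate)
import Data.Vec.Properties as Vec
open import Data.Vec.Relation.Unary.All using (All; []; _∷_)
open import Data.Vec.Relation.Unary.All.Properties using (lookup⁺)
open import Data.Vec.Relation.Unary.AllPairs as AllPairs using (AllPairs; []; _∷_)
import Data.Vec.Relation.Unary.AllPairs.Properties as AllPairs
open import Function using (_∘_)
open import Level using (_⊔_)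
open import Relation.Binary.Core using (Rel)
open import Relation.Binary.Definitions using (Symmetric; tri<; tri≈; tri>)
open import Relation.Binary.PropositionalEquality as ≡ using (_≡_; _≢_)
open import Relation.Nullary using (¬_; yes; no; Dec)

module _ {a p} {A : Set a} {P : A → Set p} where

  All-removeAt⁺ : ∀ {k} {xs : Vec A (suc k)} → All P xs → ∀ i → All P (removeAt xs i)
  All-removeAt⁺ (_ ∷ pxs) Fin.zero = pxs
  All-removeAt⁺ {xs = _ ∷ _ ∷ _} (px ∷ pxs) (Fin.suc i) = px ∷ All-removeAt⁺ pxs i

module _ {a r} {A : Set a} {R : Rel A r} where

  AllPairs-removeAt⁺ : ∀ {k} {xs : Vec A (suc k)} → AllPairs R xs → ∀ i → AllPairs R (removeAt xs i)
  AllPairs-removeAt⁺ (_ ∷ pxs) Fin.zero = pxs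
  AllPairs-removeAt⁺ {xs = _ ∷ _ ∷ _} (px ∷ pxs) (Fin.suc i) = All-removeAt⁺ px i ∷ AllPairs-removeAt⁺ pxs i

  AllPairs-lookup-removeAt : Symmetric R → ∀ {k} {xs : Vec A (suc k)} → AllPairs R xs →
                             ∀ i → All (R (lookup xs i)) (removeAt xs i)
  AllPairs-lookup-removeAt sym (px ∷ _) Fin.zero = px
  AllPairs-lookup-removeAt sym {xs = _ ∷ _ ∷ _} (px ∷ pxs) (Fin.suc i) =
    sym (lookup⁺ px i) ∷ AllPairs-lookup-removeAt sym pxs i

module IntegerCoefficients {c ℓ} (R : CommutativeRing c ℓ) where
  open CommutativeRing R
  open import Relation.Binary.Reasoning.Setoid setoid
  open import Algebra.Properties.Ring ring using (-0#≈0#; -‿involutive; -‿+-comm; -‿distribˡ-*)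
  open import Algebra.Properties.Semiring.Mult.TCOptimised semiring using (1+×; ×-homo-+; ×1-homo-*) renaming (_×_ to _×ℕ_)
  open import Algebra.Properties.CommutativeSemigroup *-commutativeSemigroup using () renaming (interchange to *-interchange)

  ⟦_⟧ : ℤ → Carrier
  ⟦ + n ⟧ = n ×ℕ 1#
  ⟦ -[1+ n ] ⟧ = - (suc n ×ℕ 1#)

  ⟦_⟧ˢ : Sign → Carrier
  ⟦ Sign.+ ⟧ˢ = 1#
  ⟦ Sign.- ⟧ˢ = - 1#

  -‿homo : ∀ i → ⟦ ℤ.- i ⟧ ≈ - ⟦ i ⟧
  -‿homo (+ zero) = sym -0#≈0#
  -‿homo (+ suc n) = refl
  -‿homo -[1+ n ] = sym (-‿involutive _)

  private
    cancel-+ˡ : ∀ x a b → (x + a) - (x + b) ≈ a - b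
    cancel-+ˡ x a b = begin
      (x + a) - (x + b)     ≈⟨ +-congˡ (sym (-‿+-comm x b)) ⟩
      (x + a) + (- x - b)   ≈⟨ +-congʳ (+-comm x a) ⟩
      (a + x) + (- x - b)   ≈⟨ +-assoc a x _ ⟩
      a + (x + (- x - b))   ≈⟨ +-congˡ (sym (+-assoc x (- x) (- b))) ⟩
      a + ((x - x) - b)     ≈⟨ +-congˡ (+-congʳ (-‿inverseʳ x)) ⟩
      a + (0# - b)          ≈⟨ +-congˡ (+-identityˡ (- b)) ⟩
      a - b                 ∎

  ⊖-homo : ∀ m n → ⟦ m ℤ.⊖ n ⟧ ≈ m ×ℕ 1# - n ×ℕ 1#
  ⊖-homo m zero = sym (trans (+-congˡ -0#≈0#) (+-identityʳ _))
  ⊖-homo zero (suc n) = sym (+-identityˡ _)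
  ⊖-homo (suc m) (suc n) rewrite ℤ.[1+m]⊖[1+n]≡m⊖n m n = begin
    ⟦ m ℤ.⊖ n ⟧                       ≈⟨ ⊖-homo m n ⟩
    m ×ℕ 1# - n ×ℕ 1#                 ≈⟨ cancel-+ˡ 1# (m ×ℕ 1#) (n ×ℕ 1#) ⟨
    (1# + m ×ℕ 1#) - (1# + n ×ℕ 1#)   ≈⟨ +-cong (1+× m 1#) (-‿cong (1+× n 1#)) ⟨
    suc m ×ℕ 1# - suc n ×ℕ 1#         ∎

  +-homo : ∀ i j → ⟦ i ℤ.+ j ⟧ ≈ ⟦ i ⟧ + ⟦ j ⟧
  +-homo (+ m) (+ n) = ×-homo-+ 1# m n
  +-homo (+ m) -[1+ n ] = ⊖-homo m (suc n)
  +-homo -[1+ m ] (+ n) = trans (⊖-homo n (suc m)) (+-comm _ _)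
  +-homo -[1+ m ] -[1+ n ] = begin
    - (suc (suc (m ℕ.+ n)) ×ℕ 1#)  ≡⟨ ≡.cong (λ k → - (suc k ×ℕ 1#)) (ℕ.+-suc m n) ⟨
    - ((suc m ℕ.+ suc n) ×ℕ 1#)    ≈⟨ -‿cong (×-homo-+ 1# (suc m) (suc n)) ⟩
    - (suc m ×ℕ 1# + suc n ×ℕ 1#)   ≈⟨ -‿+-comm _ _ ⟨
    - (suc m ×ℕ 1#) - (suc n ×ℕ 1#) ∎

  ◃-homo : ∀ s n → ⟦ s ℤ.◃ n ⟧ ≈ ⟦ s ⟧ˢ * (n ×ℕ 1#)
  ◃-homo s zero = sym (zeroʳ _)
  ◃-homo Sign.+ (suc n) = sym (*-identityˡ _)
  ◃-homo Sign.- (suc n) = trans (-‿cong (sym (*-identityˡ _))) (-‿distribˡ-* _ _)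

  sign-homo : ∀ s t → ⟦ s Sign.* t ⟧ˢ ≈ ⟦ s ⟧ˢ * ⟦ t ⟧ˢ
  sign-homo Sign.+ t = sym (*-identityˡ _)
  sign-homo Sign.- Sign.+ = sym (*-identityʳ _)
  sign-homo Sign.- Sign.- = sym (trans (sym (-‿distribˡ-* _ _)) (trans (-‿cong (*-identityˡ _)) (-‿involutive _)))

  sign-abs : ∀ i → ⟦ i ⟧ ≈ ⟦ ℤ.sign i ⟧ˢ * (ℤ.∣ i ∣ ×ℕ 1#)
  sign-abs (+ n) = sym (*-identityˡ _)
  sign-abs -[1+ n ] = trans (-‿cong (sym (*-identityˡ _))) (-‿distribˡ-* _ _)

  *-homo : ∀ i j → ⟦ i ℤ.* j ⟧ ≈ ⟦ i ⟧ * ⟦ j ⟧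
  *-homo i j = begin
    ⟦ (ℤ.sign i Sign.* ℤ.sign j) ℤ.◃ (ℤ.∣ i ∣ ℕ.* ℤ.∣ j ∣) ⟧     ≈⟨ ◃-homo (ℤ.sign i Sign.* ℤ.sign j) (ℤ.∣ i ∣ ℕ.* ℤ.∣ j ∣) ⟩
    ⟦ ℤ.sign i Sign.* ℤ.sign j ⟧ˢ * ((ℤ.∣ i ∣ ℕ.* ℤ.∣ j ∣) ×ℕ 1#) ≈⟨ *-cong (sign-homo (ℤ.sign i) (ℤ.sign j)) (×1-homo-* ℤ.∣ i ∣ ℤ.∣ j ∣) ⟩
    (⟦ ℤ.sign i ⟧ˢ * ⟦ ℤ.sign j ⟧ˢ) * (ℤ.∣ i ∣ ×ℕ 1# * ℤ.∣ j ∣ ×ℕ 1#) ≈⟨ *-interchange _ _ _ _ ⟩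
    (⟦ ℤ.sign i ⟧ˢ * ℤ.∣ i ∣ ×ℕ 1#) * (⟦ ℤ.sign j ⟧ˢ * ℤ.∣ j ∣ ×ℕ 1#) ≈⟨ *-cong (sign-abs i) (sign-abs j) ⟨
    ⟦ i ⟧ * ⟦ j ⟧                                               ∎

  ⟦⟧-morphism : ℤ.+-*-rawRing ACR.-Raw-AlmostCommutative⟶ ACR.fromCommutativeRing R
  ⟦⟧-morphism = record
    { ⟦_⟧ = ⟦_⟧ ; +-homo = +-homo ; *-homo = *-homo ; -‿homo = -‿homo ; 0-homo = refl ; 1-homo = refl }

  ⟦⟧-weaklyDecidable : ∀ i j → Maybe (⟦ i ⟧ ≈ ⟦ j ⟧)
  ⟦⟧-weaklyDecidable i j with i ℤ.≟ j
  ... | yes ≡.refl = just refl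
  ... | no _ = nothing

  open import Algebra.Solver.Ring ℤ.+-*-rawRing (ACR.fromCommutativeRing R) ⟦⟧-morphism ⟦⟧-weaklyDecidable public
    using (solve; _:=_; _:+_; _:*_; _:-_; :-_; con)

#pairs : ℕ → ℕ
#pairs zero = 0
#pairs (suc m) = m ℕ.+ #pairs m

module Exponents where
  open ≡.≡-Reasoning
  open import Data.Nat.Tactic.RingSolver using (solve-∀)
  open import Data.Integer.Tactic.RingSolver using () renaming (solve-∀ to solve-∀ℤ)

  #pairs-sq : ∀ n → 2 ℕ.* #pairs n ℕ.+ n ≡ n ℕ.* n
  #pairs-sq zero = ≡.refl
  #pairs-sq (suc n) = begin
    2 ℕ.* (n ℕ.+ #pairs n) ℕ.+ suc n            ≡⟨ expand n (#pairs n) ⟩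
    (2 ℕ.* #pairs n ℕ.+ n) ℕ.+ (2 ℕ.* n ℕ.+ 1)  ≡⟨ ≡.cong (ℕ._+ (2 ℕ.* n ℕ.+ 1)) (#pairs-sq n) ⟩
    n ℕ.* n ℕ.+ (2 ℕ.* n ℕ.+ 1)                  ≡⟨ square n ⟩
    suc n ℕ.* suc n                               ∎
    where
    expand : ∀ n T → 2 ℕ.* (n ℕ.+ T) ℕ.+ suc n ≡ (2 ℕ.* T ℕ.+ n) ℕ.+ (2 ℕ.* n ℕ.+ 1)
    expand = solve-∀
    square : ∀ n → n ℕ.* n ℕ.+ (2 ℕ.* n ℕ.+ 1) ≡ suc n ℕ.* suc n
    square = solve-∀

  double-sq : ∀ n → 2 ℕ.* n ℕ.* n ≡ 4 ℕ.* #pairs n ℕ.+ 2 ℕ.* n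
  double-sq n = begin
    2 ℕ.* n ℕ.* n                   ≡⟨ ℕ.*-assoc 2 n n ⟩
    2 ℕ.* (n ℕ.* n)                 ≡⟨ ≡.cong (2 ℕ.*_) (#pairs-sq n) ⟨
    2 ℕ.* (2 ℕ.* #pairs n ℕ.+ n)    ≡⟨ distribute n (#pairs n) ⟩
    4 ℕ.* #pairs n ℕ.+ 2 ℕ.* n      ∎
    where
    distribute : ∀ n T → 2 ℕ.* (2 ℕ.* T ℕ.+ n) ≡ 4 ℕ.* T ℕ.+ 2 ℕ.* n
    distribute = solve-∀

  #pairs-double : ∀ n → #pairs (2 ℕ.* n) ≡ 4 ℕ.* #pairs n ℕ.+ n
  #pairs-double n = ℕ.*-cancelˡ-≡ _ _ 2 (ℕ.+-cancelʳ-≡ (2 ℕ.* n) _ _ (begin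
    2 ℕ.* #pairs (2 ℕ.* n) ℕ.+ 2 ℕ.* n       ≡⟨ #pairs-sq (2 ℕ.* n) ⟩
    2 ℕ.* n ℕ.* (2 ℕ.* n)                    ≡⟨ regroup n ⟩
    2 ℕ.* (2 ℕ.* n ℕ.* n)                    ≡⟨ ≡.cong (2 ℕ.*_) (double-sq n) ⟩
    2 ℕ.* (4 ℕ.* #pairs n ℕ.+ 2 ℕ.* n)       ≡⟨ distribute n (#pairs n) ⟩
    2 ℕ.* (4 ℕ.* #pairs n ℕ.+ n) ℕ.+ 2 ℕ.* n ∎))
    where
    regroup : ∀ n → 2 ℕ.* n ℕ.* (2 ℕ.* n) ≡ 2 ℕ.* (2 ℕ.* n ℕ.* n)
    regroup = solve-∀
    distribute : ∀ n T → 2 ℕ.* (4 ℕ.* T ℕ.+ 2 ℕ.* n) ≡ 2 ℕ.* (4 ℕ.* T ℕ.+ n) ℕ.+ 2 ℕ.* n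
    distribute = solve-∀

  double-sq≡#pairs-double+n : ∀ n → 2 ℕ.* n ℕ.* n ≡ #pairs (2 ℕ.* n) ℕ.+ n
  double-sq≡#pairs-double+n n = begin
    2 ℕ.* n ℕ.* n                   ≡⟨ double-sq n ⟩
    4 ℕ.* #pairs n ℕ.+ 2 ℕ.* n      ≡⟨ regroup (#pairs n) n ⟩
    (4 ℕ.* #pairs n ℕ.+ n) ℕ.+ n    ≡⟨ ≡.cong (ℕ._+ n) (#pairs-double n) ⟨
    #pairs (2 ℕ.* n) ℕ.+ n          ∎
    where
    regroup : ∀ T n → 4 ℕ.* T ℕ.+ 2 ℕ.* n ≡ (4 ℕ.* T ℕ.+ n) ℕ.+ n
    regroup = solve-∀

  -[d+e]+e≡-d : ∀ d e → ℤ.- (+ (d ℕ.+ e)) ℤ.+ (+ e) ≡ ℤ.- (+ d)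
  -[d+e]+e≡-d d e = ≡.trans (≡.cong (λ z → ℤ.- z ℤ.+ + e) (ℤ.pos-+ d e)) (cancel (+ d) (+ e))
    where
    cancel : ∀ (a b : ℤ) → ℤ.- (a ℤ.+ b) ℤ.+ b ≡ ℤ.- a
    cancel = solve-∀ℤ

module BigOperators {c ℓ} (R : CommutativeRing c ℓ) (inv : CommutativeRing.Carrier R → CommutativeRing.Carrier R) where
  open CommutativeRing R
  open import Relation.Binary.Reasoning.Setoid setoid
  open import Algebra.Properties.CommutativeSemiring.Exp commutativeSemiring public
    using (_^_; ^-congˡ; ^-homo-*; ^-assocʳ; ^-distrib-*)
  open import Algebra.Properties.CommutativeSemigroup +-commutativeSemigroup using () renaming (interchange to +-interchange)
  open import Algebra.Properties.CommutativeSemigroup *-commutativeSemigroup using (x∙yz≈y∙xz) renaming (interchange to *-interchange)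
  open IntegerCoefficients R

  ∑ ∏ : (m : ℕ) → (Fin m → Carrier) → Carrier
  ∑ = sumFin R inv
  ∏ = prodFin R inv

  ∑-cong : ∀ m {f g : Fin m → Carrier} → (∀ i → f i ≈ g i) → ∑ m f ≈ ∑ m g
  ∑-cong zero f≈g = refl
  ∑-cong (suc m) f≈g = +-cong (f≈g Fin.zero) (∑-cong m (λ i → f≈g (Fin.suc i)))

  ∑-distrib-+ : ∀ m (f g : Fin m → Carrier) → ∑ m (λ i → f i + g i) ≈ ∑ m f + ∑ m g
  ∑-distrib-+ zero f g = sym (+-identityˡ 0#)
  ∑-distrib-+ (suc m) f g = trans (+-congˡ (∑-distrib-+ m _ _)) (+-interchange _ _ _ _)

  *-distribˡ-∑ : ∀ m k (f : Fin m → Carrier) → k * ∑ m f ≈ ∑ m (λ i → k * f i)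
  *-distribˡ-∑ zero k f = zeroʳ k
  *-distribˡ-∑ (suc m) k f = trans (distribˡ k _ _) (+-congˡ (*-distribˡ-∑ m k _))

  ∏-cong : ∀ m {f g : Fin m → Carrier} → (∀ i → f i ≈ g i) → ∏ m f ≈ ∏ m g
  ∏-cong zero f≈g = refl
  ∏-cong (suc m) f≈g = *-cong (f≈g Fin.zero) (∏-cong m (λ i → f≈g (Fin.suc i)))

  ∏-distrib-* : ∀ m (f g : Fin m → Carrier) → ∏ m (λ i → f i * g i) ≈ ∏ m f * ∏ m g
  ∏-distrib-* zero f g = sym (*-identityˡ 1#)
  ∏-distrib-* (suc m) f g = trans (*-congˡ (∏-distrib-* m _ _)) (*-interchange _ _ _ _)

  ∏-const : ∀ m k → ∏ m (λ _ → k) ≈ k ^ m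
  ∏-const zero k = refl
  ∏-const (suc m) k = *-congˡ (∏-const m k)

  ∏-removeAt : ∀ {A : Set} {k} (f : A → Carrier) (r : Vec A (suc k)) p →
    ∏ (suc k) (f ∘ lookup r) ≈ f (lookup r p) * ∏ k (f ∘ lookup (removeAt r p))
  ∏-removeAt f (x ∷ r) Fin.zero = refl
  ∏-removeAt f (x ∷ y ∷ r) (Fin.suc p) = trans (*-congˡ (∏-removeAt f (y ∷ r) p)) (x∙yz≈y∙xz _ _ _)

  pow≈^ : ∀ y n → pow R inv y n ≈ y ^ n
  pow≈^ y zero = refl
  pow≈^ y (suc n) = *-congˡ (pow≈^ y n)

  1^n≈1 : ∀ n → 1# ^ n ≈ 1#
  1^n≈1 zero = refl
  1^n≈1 (suc n) = trans (*-identityˡ _) (1^n≈1 n)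

  powℤ-neg : ∀ y d → powℤ R inv y (ℤ.- (+ d)) ≈ inv y ^ d
  powℤ-neg y zero = refl
  powℤ-neg y (suc d) = pow≈^ (inv y) (suc d)

  powℤ-neg-shifted : ∀ y {A} d e → A ≡ d ℕ.+ e → powℤ R inv y (ℤ.- (+ A) ℤ.+ (+ e)) ≈ inv y ^ d
  powℤ-neg-shifted y d e ≡.refl = trans (reflexive (≡.cong (powℤ R inv y) (Exponents.-[d+e]+e≡-d d e))) (powℤ-neg y d)

  ∏< : (m : ℕ) → (Fin m → Fin m → Carrier) → Carrier
  ∏< zero f = 1#
  ∏< (suc m) f = ∏ m (λ j → f Fin.zero (Fin.suc j)) * ∏< m (λ i j → f (Fin.suc i) (Fin.suc j))

  private
    ltEntry : ∀ {m} → (Fin m → Fin m → Carrier) → (i j : Fin m) → Dec (toℕ i ℕ.< toℕ j) → Carrier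
    ltEntry f i j (yes _) = f i j
    ltEntry f i j (no _) = 1#

    ltEntry-suc : ∀ {m} (f : Fin (suc m) → Fin (suc m) → Carrier) (i j : Fin m) →
      ltEntry f (Fin.suc i) (Fin.suc j) (toℕ (Fin.suc i) ℕ.<? toℕ (Fin.suc j))
        ≈ ltEntry (λ i j → f (Fin.suc i) (Fin.suc j)) i j (toℕ i ℕ.<? toℕ j)
    ltEntry-suc f i j with toℕ (Fin.suc i) ℕ.<? toℕ (Fin.suc j) | toℕ i ℕ.<? toℕ j
    ... | yes _ | yes _ = refl
    ... | no _ | no _ = refl
    ... | yes i<j | no i≮j = ⊥-elim (i≮j (ℕ.≤-pred i<j))
    ... | no i≮j | yes i<j = ⊥-elim (i≮j (s≤s i<j))

    ∏∏ltEntry≈∏< : ∀ m f → ∏ m (λ i → ∏ m (λ j → ltEntry f i j (toℕ i ℕ.<? toℕ j))) ≈ ∏< m f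
    ∏∏ltEntry≈∏< zero f = refl
    ∏∏ltEntry≈∏< (suc m) f = *-cong (*-identityˡ _) (begin
      ∏ m (λ i → 1# * ∏ m (λ j → ltEntry f (Fin.suc i) (Fin.suc j) (toℕ (Fin.suc i) ℕ.<? toℕ (Fin.suc j))))
        ≈⟨ ∏-cong m (λ i → trans (*-identityˡ _) (∏-cong m (ltEntry-suc f i))) ⟩
      ∏ m (λ i → ∏ m (λ j → ltEntry (λ i j → f (Fin.suc i) (Fin.suc j)) i j (toℕ i ℕ.<? toℕ j)))
        ≈⟨ ∏∏ltEntry≈∏< m _ ⟩
      ∏< m (λ i j → f (Fin.suc i) (Fin.suc j)) ∎)

    mutual
      prodPairs≈∏∏ltEntry : ∀ m f → prodPairs R inv m f ≈ ∏ m (λ i → ∏ m (λ j → ltEntry f i j (toℕ i ℕ.<? toℕ j)))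
      prodPairs≈∏∏ltEntry m f = ∏-cong m (λ i → ∏-cong m (λ j → entry f i j))

      -- The entry function of prodPairs is local to its definition, so the left side is found by unification.
      entry : ∀ {m} f (i j : Fin m) → _ ≈ ltEntry f i j (toℕ i ℕ.<? toℕ j)
      entry f i j with toℕ i ℕ.<? toℕ j
      ... | yes _ = refl
      ... | no _ = refl

  prodPairs≈∏< : ∀ m f → prodPairs R inv m f ≈ ∏< m f
  prodPairs≈∏< m f = trans (prodPairs≈∏∏ltEntry m f) (∏∏ltEntry≈∏< m f)

  ∏<-cong : ∀ m {f g : Fin m → Fin m → Carrier} → (∀ i j → toℕ i ℕ.< toℕ j → f i j ≈ g i j) → ∏< m f ≈ ∏< m g
  ∏<-cong zero f≈g = refl
  ∏<-cong (suc m) f≈g = *-cong (∏-cong m (λ j → f≈g Fin.zero (Fin.suc j) (s≤s z≤n)))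
                               (∏<-cong m (λ i j i<j → f≈g (Fin.suc i) (Fin.suc j) (s≤s i<j)))

  ∏<-distrib-* : ∀ m (f g : Fin m → Fin m → Carrier) → ∏< m (λ i j → f i j * g i j) ≈ ∏< m f * ∏< m g
  ∏<-distrib-* zero f g = sym (*-identityˡ 1#)
  ∏<-distrib-* (suc m) f g = trans (*-cong (∏-distrib-* m _ _) (∏<-distrib-* m _ _)) (*-interchange _ _ _ _)

  ∏<-scale : ∀ m k (f : Fin m → Fin m → Carrier) → ∏< m (λ i j → k * f i j) ≈ k ^ #pairs m * ∏< m f
  ∏<-scale zero k f = sym (*-identityˡ 1#)
  ∏<-scale (suc m) k f = begin
    ∏ m (λ j → k * f Fin.zero (Fin.suc j)) * ∏< m (λ i j → k * f (Fin.suc i) (Fin.suc j))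
      ≈⟨ *-cong (trans (∏-distrib-* m _ _) (*-congʳ (∏-const m k))) (∏<-scale m k _) ⟩
    (k ^ m * ∏ m (λ j → f Fin.zero (Fin.suc j))) * (k ^ #pairs m * ∏< m (λ i j → f (Fin.suc i) (Fin.suc j)))
      ≈⟨ *-interchange _ _ _ _ ⟩
    (k ^ m * k ^ #pairs m) * ∏< (suc m) f
      ≈⟨ *-congʳ (^-homo-* k m (#pairs m)) ⟨
    k ^ #pairs (suc m) * ∏< (suc m) f ∎

  ∏<-outer : ∀ m (h : Fin (suc m) → Carrier) → ∏< (suc m) (λ i j → h i * h j) ≈ ∏ (suc m) (λ i → h i ^ m)
  ∏<-outer zero h = refl
  ∏<-outer (suc m) h = begin
    ∏ (suc m) (λ j → h₀ * h (Fin.suc j)) * ∏< (suc m) (λ i j → h (Fin.suc i) * h (Fin.suc j))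
      ≈⟨ *-cong (trans (∏-distrib-* (suc m) (λ _ → h₀) (λ j → h (Fin.suc j))) (*-congʳ (∏-const (suc m) h₀))) (∏<-outer m (λ i → h (Fin.suc i))) ⟩
    (h₀ ^ suc m * ∏ (suc m) (λ j → h (Fin.suc j))) * ∏ (suc m) (λ i → h (Fin.suc i) ^ m)
      ≈⟨ *-assoc _ _ _ ⟩
    h₀ ^ suc m * (∏ (suc m) (λ j → h (Fin.suc j)) * ∏ (suc m) (λ i → h (Fin.suc i) ^ m))
      ≈⟨ *-congˡ (∏-distrib-* (suc m) (λ i → h (Fin.suc i)) (λ i → h (Fin.suc i) ^ m)) ⟨
    h₀ ^ suc m * ∏ (suc m) (λ i → h (Fin.suc i) ^ suc m) ∎
    where
    h₀ = h Fin.zero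

  ∏<-inverses : ∀ m (y : Fin m → Carrier) →
    ∏< m (λ i j → inv (y i) * inv (y j)) ≈ ∏ m (λ i → powℤ R inv (y i) (ℤ.- (+ m) ℤ.+ (+ 1)))
  ∏<-inverses zero y = refl
  ∏<-inverses (suc m) y = trans (∏<-outer m (inv ∘ y))
    (∏-cong (suc m) (λ i → sym (powℤ-neg-shifted (y i) m 1 (ℕ.+-comm 1 m))))

data Double : ℕ → ℕ → Set where
  zero : Double 0 0
  suc  : ∀ {h k} → Double h k → Double (suc h) (suc (suc k))

double : ∀ n → Double n (2 ℕ.* n)
double zero = zero
double (suc n) = ≡.subst (Double (suc n)) (≡.sym (ℕ.*-suc 2 n)) (suc (double n))

module PfaffianBasics {c ℓ} (R : CommutativeRing c ℓ) (inv : CommutativeRing.Carrier R → CommutativeRing.Carrier R) where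
  open CommutativeRing R
  open import Relation.Binary.Reasoning.Setoid setoid
  open IntegerCoefficients R
  open BigOperators R inv

  pf-cong : ∀ {m} {A B : Fin m → Fin m → Carrier} → (∀ i j → A i j ≈ B i j) →
            ∀ k v → pfAux R inv A k v ≈ pfAux R inv B k v
  pf-cong A≈B zero [] = refl
  pf-cong A≈B (suc zero) (_ ∷ []) = refl
  pf-cong A≈B (suc (suc k)) (i ∷ rest) = ∑-cong (suc k) λ p →
    *-congˡ {sgn R inv (toℕ p)} (*-cong (A≈B i (lookup rest p)) (pf-cong A≈B k (removeAt rest p)))

  pf-scale : ∀ {m} K (A : Fin m → Fin m → Carrier) {h k} → Double h k → ∀ v →
             pfAux R inv (λ i j → K * A i j) k v ≈ K ^ h * pfAux R inv A k v
  pf-scale K A zero [] = sym (*-identityʳ 1#)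
  pf-scale K A {suc h} {suc (suc k)} (suc h≡k) (i ∷ rest) =
    trans (∑-cong (suc k) term) (sym (*-distribˡ-∑ (suc k) (K ^ suc h) expansionTerm))
    where
    expansionTerm : Fin (suc k) → Carrier
    expansionTerm p = sgn R inv (toℕ p) * (A i (lookup rest p) * pfAux R inv A k (removeAt rest p))

    term : ∀ p → sgn R inv (toℕ p) * ((K * A i (lookup rest p)) * pfAux R inv (λ i j → K * A i j) k (removeAt rest p))
               ≈ K ^ suc h * expansionTerm p
    term p = trans (*-congˡ (*-congˡ (pf-scale K A h≡k (removeAt rest p))))
      (solve 5 (λ s K a P Q → s :* ((K :* a) :* (P :* Q)) := (K :* P) :* (s :* (a :* Q)))
             refl (sgn R inv (toℕ p)) K (A i (lookup rest p)) (K ^ h) (pfAux R inv A k (removeAt rest p)))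

module Field {c ℓ} (R : CommutativeRing c ℓ) (inv : CommutativeRing.Carrier R → CommutativeRing.Carrier R)
  (inverseʳ : ∀ y → CommutativeRing._≉_ R y (CommutativeRing.0# R) →
                    CommutativeRing._≈_ R (CommutativeRing._*_ R y (inv y)) (CommutativeRing.1# R))
  (1≉0 : CommutativeRing._≉_ R (CommutativeRing.1# R) (CommutativeRing.0# R))
  where

  open CommutativeRing R

  open import Relation.Binary.Reasoning.Setoid setoid
  open import Algebra.Properties.Ring ring using (-0#≈0#; -‿involutive; -‿distribʳ-*; -1*x≈-x)
  open import Algebra.Properties.CommutativeSemigroup *-commutativeSemigroup using () renaming (interchange to *-interchange)
  open IntegerCoefficients R
  open BigOperators R inv
  open PfaffianBasics R inv

  ≉0-resp-≈ : ∀ {y z} → y ≈ z → y ≉ 0# → z ≉ 0#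
  ≉0-resp-≈ y≈z y≉0 z≈0 = y≉0 (trans y≈z z≈0)

  inverseˡ : ∀ {y} → y ≉ 0# → inv y * y ≈ 1#
  inverseˡ {y} y≉0 = trans (*-comm _ _) (inverseʳ y y≉0)

  *-cancelʳ : ∀ {a b d} → d ≉ 0# → a * d ≈ b * d → a ≈ b
  *-cancelʳ {a} {b} {d} d≉0 ad≈bd = begin
    a                ≈⟨ *-identityʳ a ⟨
    a * 1#           ≈⟨ *-congˡ (inverseʳ d d≉0) ⟨
    a * (d * inv d)  ≈⟨ *-assoc a d _ ⟨
    (a * d) * inv d  ≈⟨ *-congʳ ad≈bd ⟩
    (b * d) * inv d  ≈⟨ *-assoc b d _ ⟩
    b * (d * inv d)  ≈⟨ *-congˡ (inverseʳ d d≉0) ⟩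
    b * 1#           ≈⟨ *-identityʳ b ⟩
    b                ∎

  *-≉0 : ∀ {y z} → y ≉ 0# → z ≉ 0# → y * z ≉ 0#
  *-≉0 {y} y≉0 z≉0 yz≈0 = z≉0 (*-cancelʳ y≉0 (trans (*-comm _ _) (trans yz≈0 (sym (zeroˡ y)))))

  -‿≉0 : ∀ {y} → y ≉ 0# → - y ≉ 0#
  -‿≉0 {y} y≉0 -y≈0 = y≉0 (trans (sym (-‿involutive y)) (trans (-‿cong -y≈0) -0#≈0#))

  inv-≉0 : ∀ {y} → y ≉ 0# → inv y ≉ 0#
  inv-≉0 {y} y≉0 iy≈0 = 1≉0 (trans (sym (inverseʳ y y≉0)) (trans (*-congˡ iy≈0) (zeroʳ y)))

  inv-unique : ∀ {y z} → y ≉ 0# → y * z ≈ 1# → inv y ≈ z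
  inv-unique y≉0 yz≈1 = *-cancelʳ y≉0 (trans (inverseˡ y≉0) (sym (trans (*-comm _ _) yz≈1)))

  inv-cong : ∀ {y z} → y ≉ 0# → y ≈ z → inv y ≈ inv z
  inv-cong {y} y≉0 y≈z = sym (inv-unique (≉0-resp-≈ y≈z y≉0) (trans (*-congʳ (sym y≈z)) (inverseʳ y y≉0)))

  inv-distrib-* : ∀ {y z} → y ≉ 0# → z ≉ 0# → inv (y * z) ≈ inv y * inv z
  inv-distrib-* {y} {z} y≉0 z≉0 = inv-unique (*-≉0 y≉0 z≉0) (begin
    (y * z) * (inv y * inv z)  ≈⟨ *-interchange y z (inv y) (inv z) ⟩
    (y * inv y) * (z * inv z)  ≈⟨ *-cong (inverseʳ y y≉0) (inverseʳ z z≉0) ⟩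
    1# * 1#                    ≈⟨ *-identityˡ 1# ⟩
    1#                         ∎)

  inv-involutive : ∀ {y} → y ≉ 0# → inv (inv y) ≈ y
  inv-involutive y≉0 = inv-unique (inv-≉0 y≉0) (inverseˡ y≉0)

  inv-‿ : ∀ {y} → y ≉ 0# → inv (- y) ≈ - inv y
  inv-‿ {y} y≉0 = inv-unique (-‿≉0 y≉0)
    (trans (solve 2 (λ y y' → (:- y) :* (:- y') := y :* y') refl y (inv y)) (inverseʳ y y≉0))

  inv-1 : inv 1# ≈ 1#
  inv-1 = inv-unique 1≉0 (*-identityˡ 1#)

  ∏-≉0 : ∀ m {f : Fin m → Carrier} → (∀ i → f i ≉ 0#) → ∏ m f ≉ 0#
  ∏-≉0 zero f≉0 = 1≉0
  ∏-≉0 (suc m) f≉0 = *-≉0 (f≉0 Fin.zero) (∏-≉0 m (λ i → f≉0 (Fin.suc i)))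

  ∏<-≉0 : ∀ m {f : Fin m → Fin m → Carrier} → (∀ i j → toℕ i ℕ.< toℕ j → f i j ≉ 0#) → ∏< m f ≉ 0#
  ∏<-≉0 zero f≉0 = 1≉0
  ∏<-≉0 (suc m) f≉0 = *-≉0 (∏-≉0 m (λ j → f≉0 Fin.zero (Fin.suc j) (s≤s z≤n)))
                           (∏<-≉0 m (λ i j i<j → f≉0 (Fin.suc i) (Fin.suc j) (s≤s i<j)))

  x-y≉0⇒y-x≉0 : ∀ {x y} → x - y ≉ 0# → y - x ≉ 0#
  x-y≉0⇒y-x≉0 {x} {y} = ≉0-resp-≈ (solve 2 (λ x y → :- (x :- y) := y :- x) refl x y) ∘ -‿≉0

  -- With w = tan θ and t / s = tan φ, möbius s t w = tan (θ - φ) and cot w w′ = cot (θ - θ′);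
  -- cosQ k and sinQ k are cos (k π/2) and sin (k π/2).
  möbius : Carrier → Carrier → Carrier → Carrier
  möbius s t w = (s * w - t) * inv (s + t * w)

  cot : Carrier → Carrier → Carrier
  cot w w′ = (1# + w * w′) * inv (w - w′)

  mutual
    cosQ sinQ : ℕ → Carrier
    cosQ zero = 1#
    cosQ (suc k) = - sinQ k
    sinQ zero = 0#
    sinQ (suc k) = cosQ k

  x≈x*[d*d⁻¹] : ∀ x {d} → d ≉ 0# → x ≈ x * (d * inv d)
  x≈x*[d*d⁻¹] x {d} d≉0 = sym (trans (*-congˡ (inverseʳ d d≉0)) (*-identityʳ x))

  -- The tangent subtraction formula tan α tan β = cot (α - β) (tan α - tan β) - 1.
  möbius-product : ∀ s t w w′ → s + t * w ≉ 0# → s + t * w′ ≉ 0# → w - w′ ≉ 0# →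
    möbius s t w * möbius s t w′ ≈ cot w w′ * (möbius s t w - möbius s t w′) - 1#
  möbius-product s t w w′ D≉0 D′≉0 E≉0 = begin
    A * iD * (A′ * iD′)
      ≈⟨ solve 4 (λ A iD A′ iD′ → A :* iD :* (A′ :* iD′) := (A :* A′ :* (iD :* iD′) :+ con (+ 1)) :- con (+ 1)) refl A iD A′ iD′ ⟩
    (A * A′ * (iD * iD′) + 1#) - 1#
      ≈⟨ +-congʳ (+-congˡ (trans (x≈x*[d*d⁻¹] 1# D≉0) (trans (*-identityˡ _) (x≈x*[d*d⁻¹] (D * iD) D′≉0)))) ⟩
    (A * A′ * (iD * iD′) + (D * iD) * (D′ * iD′)) - 1#
      ≈⟨ +-congʳ (solve 6 (λ s t w w′ iD iD′ →
           (s :* w :- t) :* (s :* w′ :- t) :* (iD :* iD′) :+ ((s :+ t :* w) :* iD) :* ((s :+ t :* w′) :* iD′)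
           := (s :* s :+ t :* t) :* (con (+ 1) :+ w :* w′) :* (iD :* iD′)) refl s t w w′ iD iD′) ⟩
    (s * s + t * t) * (1# + w * w′) * (iD * iD′) - 1#
      ≈⟨ +-congʳ (*-congʳ (x≈x*[d*d⁻¹] _ E≉0)) ⟩
    (s * s + t * t) * (1# + w * w′) * (E * iE) * (iD * iD′) - 1#
      ≈⟨ +-congʳ (solve 7 (λ s t w w′ iD iD′ iE →
           (s :* s :+ t :* t) :* (con (+ 1) :+ w :* w′) :* ((w :- w′) :* iE) :* (iD :* iD′)
           := ((con (+ 1) :+ w :* w′) :* iE) :* (((s :* w :- t) :* (s :+ t :* w′) :- (s :* w′ :- t) :* (s :+ t :* w)) :* (iD :* iD′)))
           refl s t w w′ iD iD′ iE) ⟩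
    cot w w′ * ((A * D′ - A′ * D) * (iD * iD′)) - 1#
      ≈⟨ +-congʳ (*-congˡ (solve 6 (λ A A′ D D′ iD iD′ → (A :* D′ :- A′ :* D) :* (iD :* iD′) := A :* iD :* (D′ :* iD′) :- A′ :* iD′ :* (D :* iD)) refl A A′ D D′ iD iD′)) ⟩
    cot w w′ * (A * iD * (D′ * iD′) - A′ * iD′ * (D * iD)) - 1#
      ≈⟨ +-congʳ (*-congˡ (+-cong (x≈x*[d*d⁻¹] _ D′≉0) (-‿cong (x≈x*[d*d⁻¹] _ D≉0)))) ⟨
    cot w w′ * (A * iD - A′ * iD′) - 1# ∎
    where
    A = s * w - t
    A′ = s * w′ - t
    D = s + t * w
    D′ = s + t * w′
    E = w - w′
    iD = inv D
    iD′ = inv D′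
    iE = inv E

  w+[-1]w′≈w-w′ : ∀ w w′ → w + - 1# * w′ ≈ w - w′
  w+[-1]w′≈w-w′ w w′ = solve 2 (λ w w′ → w :+ :- con (+ 1) :* w′ := w :- w′) refl w w′

  cot≈möbius : ∀ {w w′} → w - w′ ≉ 0# → cot w w′ ≈ möbius w (- 1#) w′
  cot≈möbius {w} {w′} E≉0 = *-cong (solve 2 (λ w w′ → con (+ 1) :+ w :* w′ := w :* w′ :- :- con (+ 1)) refl w w′)
                                    (inv-cong E≉0 (sym (w+[-1]w′≈w-w′ w w′)))

  cot-antisym : ∀ {w w′} → w - w′ ≉ 0# → cot w′ w ≈ - cot w w′
  cot-antisym {w} {w′} E≉0 = begin
    (1# + w′ * w) * inv (w′ - w)     ≈⟨ *-cong (+-congˡ (*-comm w′ w)) (inv-cong (x-y≉0⇒y-x≉0 E≉0) (solve 2 (λ w w′ → w′ :- w := :- (w :- w′)) refl w w′)) ⟩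
    (1# + w * w′) * inv (- (w - w′)) ≈⟨ *-congˡ (inv-‿ E≉0) ⟩
    (1# + w * w′) * - inv (w - w′)   ≈⟨ -‿distribʳ-* _ _ ⟨
    - cot w w′                        ∎

  module PartialFractions {X : Set} (val : X → Carrier) where

    Apart : X → X → Set ℓ
    Apart x y = val x - val y ≉ 0#

    coeff : ∀ {k} → Vec X k → Fin k → Carrier
    coeff {suc k} ws p = ∏ k (λ q → cot (val (lookup ws p)) (val (lookup (removeAt ws p) q)))

    record Expansion {k} (ws : Vec X k) : Set (c ⊔ ℓ) where
      field
        expansion : ∀ s t → (∀ q → s + t * val (lookup ws q) ≉ 0#) →
          ∏ k (λ q → möbius s t (val (lookup ws q))) ≈ cosQ k + ∑ k (λ p → coeff ws p * möbius s t (val (lookup ws p)))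
        coeff-sum : ∑ k (coeff ws) ≈ sinQ k

    ∷-expansion : ∀ {k} u y (ys : Vec X k) → All (Apart u) (y ∷ ys) → Expansion (y ∷ ys) → Expansion (u ∷ y ∷ ys)
    ∷-expansion {k} u y ys u#vs IH = record { expansion = expand ; coeff-sum = sum }
      where
      open Expansion IH renaming (expansion to expand-vs; coeff-sum to sum-vs)
      vs = y ∷ ys
      v : Fin (suc k) → Carrier
      v p = val (lookup vs p)
      B = coeff vs
      C = cosQ (suc k)
      S = sinQ (suc k)
      b : Fin (suc k) → Carrier
      b p = cot (v p) (val u) * B p
      X₂ = ∑ (suc k) b

      u-v≉0 : ∀ p → val u - v p ≉ 0#
      u-v≉0 = lookup⁺ u#vs

      cot-u-v : ∀ p → B p * möbius (val u) (- 1#) (v p) ≈ - 1# * b p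
      cot-u-v p = begin
        B p * möbius (val u) (- 1#) (v p) ≈⟨ *-congˡ (cot≈möbius (u-v≉0 p)) ⟨
        B p * cot (val u) (v p)            ≈⟨ *-congˡ (cot-antisym (x-y≉0⇒y-x≉0 (u-v≉0 p))) ⟩
        B p * - cot (v p) (val u)          ≈⟨ solve 2 (λ B c → B :* (:- c) := :- con (+ 1) :* (c :* B)) refl (B p) _ ⟩
        - 1# * b p                         ∎

      -- the expansion of vs evaluated at (s, t) = (u, -1), the pole of the new factor
      leading : coeff (u ∷ vs) Fin.zero ≈ C - X₂
      leading = begin
        ∏ (suc k) (λ q → cot (val u) (v q))
          ≈⟨ ∏-cong (suc k) (λ q → cot≈möbius (u-v≉0 q)) ⟩
        ∏ (suc k) (λ q → möbius (val u) (- 1#) (v q))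
          ≈⟨ expand-vs (val u) (- 1#) (λ q → ≉0-resp-≈ (sym (w+[-1]w′≈w-w′ _ _)) (u-v≉0 q)) ⟩
        C + ∑ (suc k) (λ p → B p * möbius (val u) (- 1#) (v p))
          ≈⟨ +-congˡ (trans (∑-cong (suc k) cot-u-v) (sym (*-distribˡ-∑ (suc k) (- 1#) b))) ⟩
        C + - 1# * X₂
          ≈⟨ +-congˡ (-1*x≈-x X₂) ⟩
        C - X₂ ∎

      sum : coeff (u ∷ vs) Fin.zero + X₂ ≈ C
      sum = trans (+-congʳ leading) (solve 2 (λ C X → C :- X :+ X := C) refl C X₂)

      expand : ∀ s t → (∀ q → s + t * val (lookup (u ∷ vs) q) ≉ 0#) →
        möbius s t (val u) * ∏ (suc k) (λ q → möbius s t (v q))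
          ≈ - S + (coeff (u ∷ vs) Fin.zero * möbius s t (val u) + ∑ (suc k) (λ p → b p * möbius s t (v p)))
      expand s t D≉0 = begin
        Hᵤ * ∏ (suc k) H
          ≈⟨ *-congˡ (expand-vs s t (D≉0 ∘ Fin.suc)) ⟩
        Hᵤ * (C + ∑ (suc k) (λ p → B p * H p))
          ≈⟨ trans (distribˡ Hᵤ C _) (+-congˡ (*-distribˡ-∑ (suc k) Hᵤ (λ p → B p * H p))) ⟩
        Hᵤ * C + ∑ (suc k) (λ p → Hᵤ * (B p * H p))
          ≈⟨ +-congˡ (∑-cong (suc k) term) ⟩
        Hᵤ * C + ∑ (suc k) (λ p → (b p * H p + - Hᵤ * b p) + - 1# * B p)
          ≈⟨ +-congˡ (trans (∑-distrib-+ (suc k) (λ p → b p * H p + - Hᵤ * b p) (λ p → - 1# * B p))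
                            (+-cong (∑-distrib-+ (suc k) (λ p → b p * H p) (λ p → - Hᵤ * b p))
                                    (sym (*-distribˡ-∑ (suc k) (- 1#) B)))) ⟩
        Hᵤ * C + ((∑ (suc k) (λ p → b p * H p) + ∑ (suc k) (λ p → - Hᵤ * b p)) + - 1# * ∑ (suc k) B)
          ≈⟨ +-congˡ (+-cong (+-congˡ (sym (*-distribˡ-∑ (suc k) (- Hᵤ) b))) (*-congˡ sum-vs)) ⟩
        Hᵤ * C + ((∑ (suc k) (λ p → b p * H p) + - Hᵤ * X₂) + - 1# * S)
          ≈⟨ solve 5 (λ Hᵤ C Y X₂ S → Hᵤ :* C :+ ((Y :+ (:- Hᵤ) :* X₂) :+ :- con (+ 1) :* S)
                                      := :- S :+ ((C :- X₂) :* Hᵤ :+ Y)) refl Hᵤ C _ X₂ S ⟩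
        - S + ((C - X₂) * Hᵤ + ∑ (suc k) (λ p → b p * H p))
          ≈⟨ +-congˡ (+-congʳ (*-congʳ leading)) ⟨
        - S + (coeff (u ∷ vs) Fin.zero * Hᵤ + ∑ (suc k) (λ p → b p * H p)) ∎
        where
        Hᵤ = möbius s t (val u)
        H : Fin (suc k) → Carrier
        H p = möbius s t (v p)
        term : ∀ p → Hᵤ * (B p * H p) ≈ (b p * H p + - Hᵤ * b p) + - 1# * B p
        term p = begin
          Hᵤ * (B p * H p)
            ≈⟨ solve 3 (λ Hᵤ B H → Hᵤ :* (B :* H) := B :* (H :* Hᵤ)) refl Hᵤ (B p) (H p) ⟩
          B p * (H p * Hᵤ)
            ≈⟨ *-congˡ (möbius-product s t (v p) (val u) (D≉0 (Fin.suc p)) (D≉0 Fin.zero) (x-y≉0⇒y-x≉0 (u-v≉0 p))) ⟩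
          B p * (cot (v p) (val u) * (H p - Hᵤ) - 1#)
            ≈⟨ solve 4 (λ B c H Hᵤ → B :* (c :* (H :- Hᵤ) :- con (+ 1)) := ((c :* B) :* H :+ (:- Hᵤ) :* (c :* B)) :+ :- con (+ 1) :* B)
                     refl (B p) (cot (v p) (val u)) (H p) Hᵤ ⟩
          (b p * H p + - Hᵤ * b p) + - 1# * B p ∎

    partialFractions : ∀ {k} (ws : Vec X k) → AllPairs Apart ws → Expansion ws
    partialFractions [] [] = record { expansion = λ _ _ _ → sym (+-identityʳ 1#) ; coeff-sum = refl }
    partialFractions (w ∷ []) _ = record
      { expansion = λ s t _ → solve 1 (λ H → H :* con (+ 1) := :- con (+ 0) :+ (con (+ 1) :* H :+ con (+ 0))) refl _
      ; coeff-sum = +-identityʳ 1# }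
    partialFractions (u ∷ y ∷ ys) (u#vs ∷ apart) = ∷-expansion u y ys u#vs (partialFractions (y ∷ ys) apart)

  cosQ-odd : ∀ {h k} → Double h k → cosQ (suc k) ≈ 0#
  cosQ-odd zero = -0#≈0#
  cosQ-odd (suc h≡k) = trans (-‿cong (cosQ-odd h≡k)) -0#≈0#

  -1^even : ∀ {h k} → Double h k → (- 1#) ^ k ≈ 1#
  -1^even zero = refl
  -1^even {k = suc (suc k)} (suc h≡k) = begin
    - 1# * (- 1# * (- 1#) ^ k) ≈⟨ solve 1 (λ x → :- con (+ 1) :* (:- con (+ 1) :* x) := x) refl _ ⟩
    (- 1#) ^ k                  ≈⟨ -1^even h≡k ⟩
    1#                          ∎

  module Schur {m} (u : Fin m → Carrier) where
    open PartialFractions u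

    a : Fin m → Fin m → Carrier
    a i j = möbius 1# (u i) (u j)

    Admissible : Fin m → Fin m → Set ℓ
    Admissible i j = Apart i j × 1# + u i * u j ≉ 0#

    admissible-sym : Symmetric Admissible
    admissible-sym (i#j , 1+uᵢuⱼ≉0) = x-y≉0⇒y-x≉0 i#j , ≉0-resp-≈ (+-congˡ (*-comm _ _)) 1+uᵢuⱼ≉0

    a-antisym : ∀ {i j} → 1# + u i * u j ≉ 0# → a i j ≈ - a j i
    a-antisym {i} {j} 1+uᵢuⱼ≉0 = begin
      (1# * u j - u i) * inv (1# + u i * u j)    ≈⟨ *-congˡ (inv-cong 1+uᵢuⱼ≉0 (+-congˡ (*-comm (u i) (u j)))) ⟩
      (1# * u j - u i) * inv (1# + u j * u i)    ≈⟨ solve 3 (λ x y d → (con (+ 1) :* y :- x) :* d := :- ((con (+ 1) :* x :- y) :* d)) refl (u i) (u j) _ ⟩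
      - a j i                                     ∎

    cot*a≈-1 : ∀ {i j} → Admissible i j → cot (u i) (u j) * a i j ≈ - 1#
    cot*a≈-1 {i} {j} (i#j , 1+uᵢuⱼ≉0) = begin
      ((1# + x * y) * inv (x - y)) * ((1# * y - x) * inv (1# + x * y))
        ≈⟨ solve 4 (λ x y iE iD → ((con (+ 1) :+ x :* y) :* iE) :* ((con (+ 1) :* y :- x) :* iD)
                                  := :- (((con (+ 1) :+ x :* y) :* iD) :* ((x :- y) :* iE))) refl x y _ _ ⟩
      - (((1# + x * y) * inv (1# + x * y)) * ((x - y) * inv (x - y)))
        ≈⟨ -‿cong (*-cong (inverseʳ _ 1+uᵢuⱼ≉0) (inverseʳ _ i#j)) ⟩
      - (1# * 1#)
        ≈⟨ -‿cong (*-identityˡ 1#) ⟩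
      - 1# ∎
      where
      x = u i
      y = u j

    rowProduct : ∀ {k} → Fin m → Vec (Fin m) k → Carrier
    rowProduct {k} i r = ∏ k (a i ∘ lookup r)

    pairProduct : ∀ {k} → Vec (Fin m) k → Carrier
    pairProduct [] = 1#
    pairProduct (i ∷ r) = rowProduct i r * pairProduct r

    pairProduct-removeAt : ∀ {k} {r : Vec (Fin m) (suc k)} → AllPairs Admissible r → ∀ p →
      pairProduct r ≈ sgn R inv (toℕ p) * (rowProduct (lookup r p) (removeAt r p) * pairProduct (removeAt r p))
    pairProduct-removeAt {r = _ ∷ _} _ Fin.zero = sym (*-identityˡ _)
    pairProduct-removeAt {r = x ∷ y ∷ r} (x#r ∷ admissible) (Fin.suc p) = begin
      rowProduct x (y ∷ r) * pairProduct (y ∷ r)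
        ≈⟨ *-cong (∏-removeAt (a x) (y ∷ r) p) (pairProduct-removeAt admissible p) ⟩
      (a x w * rowProduct x r′) * (± * (rowProduct w r′ * pairProduct r′))
        ≈⟨ *-congʳ (*-congʳ (a-antisym (proj₂ (lookup⁺ x#r p)))) ⟩
      (- a w x * rowProduct x r′) * (± * (rowProduct w r′ * pairProduct r′))
        ≈⟨ solve 5 (λ A B s C D → (:- A :* B) :* (s :* (C :* D)) := (:- con (+ 1) :* s) :* ((A :* C) :* (B :* D)))
                   refl (a w x) (rowProduct x r′) ± (rowProduct w r′) (pairProduct r′) ⟩
      (- 1# * ±) * ((a w x * rowProduct w r′) * (rowProduct x r′ * pairProduct r′)) ∎
      where
      w = lookup (y ∷ r) p
      r′ = removeAt (y ∷ r) p
      ± = sgn R inv (toℕ p)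

    coeff*rowProduct≈1 : ∀ {h k} → Double h k → {r : Vec (Fin m) (suc k)} → AllPairs Admissible r → ∀ p →
      coeff r p * rowProduct (lookup r p) (removeAt r p) ≈ 1#
    coeff*rowProduct≈1 {k = k} h≡k {r} admissible p = begin
      ∏ k (λ q → cot (u w) (u (r′ q))) * ∏ k (λ q → a w (r′ q)) ≈⟨ ∏-distrib-* k _ _ ⟨
      ∏ k (λ q → cot (u w) (u (r′ q)) * a w (r′ q))            ≈⟨ ∏-cong k (λ q → cot*a≈-1 (lookup⁺ w#r′ q)) ⟩
      ∏ k (λ _ → - 1#)                                           ≈⟨ ∏-const k (- 1#) ⟩
      (- 1#) ^ k                                                 ≈⟨ -1^even h≡k ⟩
      1#                                                         ∎
      where
      w = lookup r p
      r′ = lookup (removeAt r p)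
      w#r′ = AllPairs-lookup-removeAt admissible-sym admissible p

    rowProduct-expansion : ∀ {h k} → Double h k → ∀ {i} {r : Vec (Fin m) (suc k)} →
      All (Admissible i) r → AllPairs Apart r → rowProduct i r ≈ ∑ (suc k) (λ p → coeff r p * a i (lookup r p))
    rowProduct-expansion {k = k} h≡k {i} {r} i#r apart = begin
      rowProduct i r              ≈⟨ Expansion.expansion (partialFractions r apart) 1# (u i) (proj₂ ∘ lookup⁺ i#r) ⟩
      cosQ (suc k) + expansion     ≈⟨ +-congʳ (cosQ-odd h≡k) ⟩
      0# + expansion               ≈⟨ +-identityˡ expansion ⟩
      expansion                    ∎
      where
      expansion = ∑ (suc k) (λ p → coeff r p * a i (lookup r p))

    schur : ∀ {h k} → Double h k → {v : Vec (Fin m) k} → AllPairs Admissible v → pfAux R inv a k v ≈ pairProduct v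
    schur zero {[]} [] = refl
    schur {k = suc (suc k)} (suc h≡k) {i ∷ rest} (i#rest ∷ admissible) = begin
      ∑ (suc k) (λ p → sgn R inv (toℕ p) * (a i (lookup rest p) * pfAux R inv a k (removeAt rest p)))
        ≈⟨ ∑-cong (suc k) term ⟩
      ∑ (suc k) (λ p → pairProduct rest * (coeff rest p * a i (lookup rest p)))
        ≈⟨ *-distribˡ-∑ (suc k) (pairProduct rest) (λ p → coeff rest p * a i (lookup rest p)) ⟨
      pairProduct rest * ∑ (suc k) (λ p → coeff rest p * a i (lookup rest p))
        ≈⟨ *-congˡ (rowProduct-expansion h≡k i#rest (AllPairs.map proj₁ admissible)) ⟨
      pairProduct rest * rowProduct i rest
        ≈⟨ *-comm _ _ ⟩
      pairProduct (i ∷ rest) ∎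
      where
      term : ∀ p → sgn R inv (toℕ p) * (a i (lookup rest p) * pfAux R inv a k (removeAt rest p))
                 ≈ pairProduct rest * (coeff rest p * a i (lookup rest p))
      term p = begin
        ± * (aᵢ * pfAux R inv a k r′)
          ≈⟨ *-congˡ (*-congˡ (schur h≡k (AllPairs-removeAt⁺ admissible p))) ⟩
        ± * (aᵢ * pairProduct r′)
          ≈⟨ *-identityʳ _ ⟨
        ± * (aᵢ * pairProduct r′) * 1#
          ≈⟨ *-congˡ (coeff*rowProduct≈1 h≡k admissible p) ⟨
        ± * (aᵢ * pairProduct r′) * (coeff rest p * rowProduct w r′)
          ≈⟨ solve 5 (λ s A P c Q → s :* (A :* P) :* (c :* Q) := (s :* (Q :* P)) :* (c :* A))
                     refl ± aᵢ (pairProduct r′) (coeff rest p) (rowProduct w r′) ⟩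
        (± * (rowProduct w r′ * pairProduct r′)) * (coeff rest p * aᵢ)
          ≈⟨ *-congʳ (pairProduct-removeAt admissible p) ⟨
        pairProduct rest * (coeff rest p * aᵢ) ∎
        where
        ± = sgn R inv (toℕ p)
        w = lookup rest p
        aᵢ = a i w
        r′ = removeAt rest p

    pairProduct-tabulate : ∀ k (g : Fin k → Fin m) → pairProduct (tabulate g) ≈ ∏< k (λ i j → a (g i) (g j))
    pairProduct-tabulate zero g = refl
    pairProduct-tabulate (suc k) g =
      *-cong (∏-cong k (λ q → reflexive (≡.cong (a (g Fin.zero)) (Vec.lookup∘tabulate (g ∘ Fin.suc) q))))
             (pairProduct-tabulate k (g ∘ Fin.suc))

    pf≈∏< : ∀ {h} → Double h m → (∀ i j → toℕ i ℕ.< toℕ j → Admissible i j) → Pf R inv m a ≈ ∏< m a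
    pf≈∏< h≡m admissible = trans (schur h≡m (AllPairs.tabulate⁺ admissible′)) (pairProduct-tabulate m (λ i → i))
      where
      admissible′ : ∀ {i j} → i ≢ j → Admissible i j
      admissible′ {i} {j} i≢j with Fin.<-cmp i j
      ... | tri< i<j _ _ = admissible i j i<j
      ... | tri≈ _ i≡j _ = ⊥-elim (i≢j i≡j)
      ... | tri> _ _ j<i = admissible-sym (admissible j i j<i)

  module Entries (ζ : Carrier) (ζ²≈-1 : ζ * ζ ≈ - 1#) where

    ζ≉0 : ζ ≉ 0#
    ζ≉0 ζ≈0 = 1≉0 (begin
      1#         ≈⟨ -‿involutive 1# ⟨
      - (- 1#)   ≈⟨ -‿cong ζ²≈-1 ⟨
      - (ζ * ζ)  ≈⟨ -‿cong (trans (*-congʳ ζ≈0) (zeroˡ ζ)) ⟩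
      - 0#       ≈⟨ -0#≈0# ⟩
      0#         ∎)

    inv-ζ : inv ζ ≈ - ζ
    inv-ζ = inv-unique ζ≉0 (begin
      ζ * - ζ    ≈⟨ -‿distribʳ-* ζ ζ ⟨
      - (ζ * ζ)  ≈⟨ -‿cong ζ²≈-1 ⟩
      - (- 1#)   ≈⟨ -‿involutive 1# ⟩
      1#         ∎)

    σ-ζ : σ R inv ζ ≈ two R inv * ζ
    σ-ζ = trans (+-congˡ (-‿cong inv-ζ)) (solve 1 (λ z → z :- (:- z) := (con (+ 1) :+ con (+ 1)) :* z) refl ζ)

    σ-ζ* : ∀ {y} → y ≉ 0# → σ R inv (ζ * y) ≈ ζ * (y + inv y)
    σ-ζ* {y} y≉0 = begin
      ζ * y - inv (ζ * y)     ≈⟨ +-congˡ (-‿cong (trans (inv-distrib-* ζ≉0 y≉0) (*-congʳ inv-ζ))) ⟩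
      ζ * y - (- ζ * inv y)   ≈⟨ solve 3 (λ z y y′ → z :* y :- (:- z :* y′) := z :* (y :+ y′)) refl ζ y (inv y) ⟩
      ζ * (y + inv y)         ∎

    σ-ζ÷ : ∀ {y} → y ≉ 0# → σ R inv (_÷_ R inv ζ y) ≈ ζ * (y + inv y)
    σ-ζ÷ {y} y≉0 = begin
      ζ * inv y - inv (ζ * inv y)  ≈⟨ +-congˡ (-‿cong (trans (inv-distrib-* ζ≉0 (inv-≉0 y≉0)) (*-cong inv-ζ (inv-involutive y≉0)))) ⟩
      ζ * inv y - (- ζ * y)        ≈⟨ solve 3 (λ z y y′ → z :* y′ :- (:- z :* y) := z :* (y :+ y′)) refl ζ y (inv y) ⟩
      ζ * (y + inv y)              ∎

    K : Carrier → Carrier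
    K b = two R inv * (b * b) * - ζ

    private
      ζ/2 : Carrier
      ζ/2 = inv (two R inv) * ζ

      inv-σ-ζ*-1≈ζ/2 : two R inv ≉ 0# → inv (σ R inv ζ) * - 1# ≈ ζ/2
      inv-σ-ζ*-1≈ζ/2 2≉0 = begin
        inv (σ R inv ζ) * - 1#        ≈⟨ *-congʳ (inv-cong (≉0-resp-≈ (sym σ-ζ) (*-≉0 2≉0 ζ≉0)) σ-ζ) ⟩
        inv (two R inv * ζ) * - 1#    ≈⟨ *-congʳ (trans (inv-distrib-* 2≉0 ζ≉0) (*-congˡ inv-ζ)) ⟩
        inv (two R inv) * - ζ * - 1#  ≈⟨ solve 2 (λ h z → h :* (:- z) :* (:- con (+ 1)) := h :* z) refl (inv (two R inv)) ζ ⟩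
        ζ/2                             ∎

      inv[b]²*K*ζ/2≈1 : ∀ {b} → two R inv ≉ 0# → b ≉ 0# → inv b ^ 2 * K b * ζ/2 ≈ 1#
      inv[b]²*K*ζ/2≈1 {b} 2≉0 b≉0 = begin
        inv b ^ 2 * K b * ζ/2
          ≈⟨ solve 5 (λ b b′ t t′ z → b′ :* (b′ :* con (+ 1)) :* (t :* (b :* b) :* (:- z)) :* (t′ :* z)
                                     := :- ((b :* b′) :* (b :* b′) :* (t :* t′) :* (z :* z)))
                     refl b (inv b) (two R inv) (inv (two R inv)) ζ ⟩
        - ((b * inv b) * (b * inv b) * (two R inv * inv (two R inv)) * (ζ * ζ))
          ≈⟨ -‿cong (*-cong (*-cong (*-cong (inverseʳ b b≉0) (inverseʳ b b≉0)) (inverseʳ _ 2≉0)) ζ²≈-1) ⟩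
        - (1# * 1# * 1# * - 1#)
          ≈⟨ solve 0 (:- (con (+ 1) :* con (+ 1) :* con (+ 1) :* :- con (+ 1)) := con (+ 1)) refl ⟩
        1# ∎

      ζ/2^4≈inv[2]^4 : ζ/2 ^ 4 ≈ inv (two R inv) ^ 4
      ζ/2^4≈inv[2]^4 = begin
        ζ/2 ^ 4                              ≈⟨ ^-distrib-* (inv (two R inv)) ζ 4 ⟩
        inv (two R inv) ^ 4 * ζ ^ 4        ≈⟨ *-congˡ (solve 1 (λ z → z :* (z :* (z :* (z :* con (+ 1)))) := (z :* z) :* (z :* z)) refl ζ) ⟩
        inv (two R inv) ^ 4 * ((ζ * ζ) * (ζ * ζ))  ≈⟨ *-congˡ (trans (*-cong ζ²≈-1 ζ²≈-1) (solve 0 (:- con (+ 1) :* :- con (+ 1) := con (+ 1)) refl)) ⟩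
        inv (two R inv) ^ 4 * 1#           ≈⟨ *-identityʳ _ ⟩
        inv (two R inv) ^ 4                ∎

    -- As σ ζ = 2ζ and #pairs (2n) = 4T + n with T = #pairs n, the scalars are (ζ/2)^(4T) (ζ/2 · K b / b²)ⁿ,
    -- where ζ/2 · K b / b² = 1 and ζ⁴ = 1.
    scalars : ∀ n {b} → two R inv ≉ 0# → b ≉ 0# →
      powℤ R inv b (ℤ.- (+ (2 ℕ.* n))) * (powℤ R inv (σ R inv ζ) (ℤ.- (+ (2 ℕ.* n ℕ.* n)) ℤ.+ (+ n)) * (K b ^ n * (- 1#) ^ #pairs (2 ℕ.* n)))
        ≈ powℤ R inv (two R inv) (ℤ.- (+ (2 ℕ.* n ℕ.* n)) ℤ.+ (+ (2 ℕ.* n)))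
    scalars n {b} 2≉0 b≉0 = begin
      powℤ R inv b (ℤ.- (+ (2 ℕ.* n))) * (powℤ R inv (σ R inv ζ) (ℤ.- (+ (2 ℕ.* n ℕ.* n)) ℤ.+ (+ n)) * (K b ^ n * (- 1#) ^ N))
        ≈⟨ *-cong (powℤ-neg b (2 ℕ.* n)) (*-congʳ (powℤ-neg-shifted (σ R inv ζ) N n (Exponents.double-sq≡#pairs-double+n n))) ⟩
      inv b ^ (2 ℕ.* n) * (inv (σ R inv ζ) ^ N * (K b ^ n * (- 1#) ^ N))
        ≈⟨ solve 4 (λ A B C D → A :* (B :* (C :* D)) := (A :* C) :* (B :* D)) refl _ _ _ _ ⟩
      (inv b ^ (2 ℕ.* n) * K b ^ n) * (inv (σ R inv ζ) ^ N * (- 1#) ^ N)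
        ≈⟨ *-cong (trans (*-congʳ (sym (^-assocʳ (inv b) 2 n))) (sym (^-distrib-* _ _ n)))
                  (trans (sym (^-distrib-* _ _ N)) (^-congˡ N (inv-σ-ζ*-1≈ζ/2 2≉0))) ⟩
      (inv b ^ 2 * K b) ^ n * ζ/2 ^ N
        ≈⟨ *-congˡ (trans (reflexive (≡.cong (ζ/2 ^_) (Exponents.#pairs-double n))) (^-homo-* ζ/2 (4 ℕ.* T) n)) ⟩
      (inv b ^ 2 * K b) ^ n * (ζ/2 ^ (4 ℕ.* T) * ζ/2 ^ n)
        ≈⟨ solve 3 (λ X Y Z → X :* (Y :* Z) := (X :* Z) :* Y) refl _ _ _ ⟩
      ((inv b ^ 2 * K b) ^ n * ζ/2 ^ n) * ζ/2 ^ (4 ℕ.* T)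
        ≈⟨ *-cong (trans (sym (^-distrib-* _ ζ/2 n)) (trans (^-congˡ n (inv[b]²*K*ζ/2≈1 2≉0 b≉0)) (1^n≈1 n)))
                  (sym (^-assocʳ ζ/2 4 T)) ⟩
      1# * (ζ/2 ^ 4) ^ T
        ≈⟨ trans (*-identityˡ _) (trans (^-congˡ T ζ/2^4≈inv[2]^4) (^-assocʳ (inv (two R inv)) 4 T)) ⟩
      inv (two R inv) ^ (4 ℕ.* T)
        ≈⟨ powℤ-neg-shifted (two R inv) (4 ℕ.* T) (2 ℕ.* n) (Exponents.double-sq n) ⟨
      powℤ R inv (two R inv) (ℤ.- (+ (2 ℕ.* n ℕ.* n)) ℤ.+ (+ (2 ℕ.* n))) ∎
      where
      T = #pairs n
      N = #pairs (2 ℕ.* n)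

    module _ {n} (x : Fin (2 ℕ.* n) → Carrier) (x≉0 : ∀ i → x i ≉ 0#) where

      u x⁻¹ : Fin (2 ℕ.* n) → Carrier
      u i = x i * x i
      x⁻¹ i = inv (x i)

      open Schur u using (a; Admissible; pf≈∏<)

      inv[xx] : ∀ i j → inv (x i * x j) ≈ x⁻¹ i * x⁻¹ j
      inv[xx] i j = inv-distrib-* (x≉0 i) (x≉0 j)

      σ-ratio : ∀ i j → σ R inv (_÷_ R inv (x j) (x i)) ≈ (u j - u i) * (x⁻¹ i * x⁻¹ j)
      σ-ratio i j = begin
        x j * x⁻¹ i - inv (x j * x⁻¹ i)
          ≈⟨ +-congˡ (-‿cong (trans (inv-distrib-* (x≉0 j) (inv-≉0 (x≉0 i))) (*-congˡ (inv-involutive (x≉0 i))))) ⟩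
        x j * x⁻¹ i - x⁻¹ j * x i
          ≈⟨ +-cong (x≈x*[d*d⁻¹] _ (x≉0 j)) (-‿cong (x≈x*[d*d⁻¹] _ (x≉0 i))) ⟩
        x j * x⁻¹ i * (x j * x⁻¹ j) - x⁻¹ j * x i * (x i * x⁻¹ i)
          ≈⟨ solve 4 (λ xᵢ xⱼ yᵢ yⱼ → xⱼ :* yᵢ :* (xⱼ :* yⱼ) :- yⱼ :* xᵢ :* (xᵢ :* yᵢ) := (xⱼ :* xⱼ :- xᵢ :* xᵢ) :* (yᵢ :* yⱼ))
                     refl (x i) (x j) (x⁻¹ i) (x⁻¹ j) ⟩
        (u j - u i) * (x⁻¹ i * x⁻¹ j) ∎

      xx+inv[xx] : ∀ i j → x i * x j + inv (x i * x j) ≈ (1# + u i * u j) * (x⁻¹ i * x⁻¹ j)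
      xx+inv[xx] i j = begin
        x i * x j + inv (x i * x j)
          ≈⟨ +-cong (trans (x≈x*[d*d⁻¹] _ (x≉0 i)) (x≈x*[d*d⁻¹] _ (x≉0 j))) (inv[xx] i j) ⟩
        x i * x j * (x i * x⁻¹ i) * (x j * x⁻¹ j) + x⁻¹ i * x⁻¹ j
          ≈⟨ solve 4 (λ xᵢ xⱼ yᵢ yⱼ → xᵢ :* xⱼ :* (xᵢ :* yᵢ) :* (xⱼ :* yⱼ) :+ yᵢ :* yⱼ
                                      := (con (+ 1) :+ xᵢ :* xᵢ :* (xⱼ :* xⱼ)) :* (yᵢ :* yⱼ)) refl (x i) (x j) (x⁻¹ i) (x⁻¹ j) ⟩
        (1# + u i * u j) * (x⁻¹ i * x⁻¹ j) ∎

      D : Fin (2 ℕ.* n) → Fin (2 ℕ.* n) → Carrier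
      D i j = ζ * ((1# + u i * u j) * (x⁻¹ i * x⁻¹ j))

      σ-ζxx : ∀ i j → σ R inv (ζ * (x i * x j)) ≈ D i j
      σ-ζxx i j = trans (σ-ζ* (*-≉0 (x≉0 i) (x≉0 j))) (*-congˡ (xx+inv[xx] i j))

      σ-ζ÷xx : ∀ i j → σ R inv (_÷_ R inv ζ (x i * x j)) ≈ D i j
      σ-ζ÷xx i j = trans (σ-ζ÷ (*-≉0 (x≉0 i) (x≉0 j))) (*-congˡ (xx+inv[xx] i j))

      D≉0 : ∀ {i j} → 1# + u i * u j ≉ 0# → D i j ≉ 0#
      D≉0 {i} {j} 1+uᵢuⱼ≉0 = *-≉0 ζ≉0 (*-≉0 1+uᵢuⱼ≉0 (*-≉0 (inv-≉0 (x≉0 i)) (inv-≉0 (x≉0 j))))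

      inv-D : ∀ {i j} → 1# + u i * u j ≉ 0# → inv (D i j) ≈ - ζ * (inv (1# + u i * u j) * (x i * x j))
      inv-D {i} {j} 1+uᵢuⱼ≉0 = begin
        inv (ζ * ((1# + u i * u j) * (x⁻¹ i * x⁻¹ j)))
          ≈⟨ inv-distrib-* ζ≉0 (*-≉0 1+uᵢuⱼ≉0 x⁻¹ᵢx⁻¹ⱼ≉0) ⟩
        inv ζ * inv ((1# + u i * u j) * (x⁻¹ i * x⁻¹ j))
          ≈⟨ *-cong inv-ζ (inv-distrib-* 1+uᵢuⱼ≉0 x⁻¹ᵢx⁻¹ⱼ≉0) ⟩
        - ζ * (inv (1# + u i * u j) * inv (x⁻¹ i * x⁻¹ j))
          ≈⟨ *-congˡ (*-congˡ (trans (inv-distrib-* (inv-≉0 (x≉0 i)) (inv-≉0 (x≉0 j)))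
                                     (*-cong (inv-involutive (x≉0 i)) (inv-involutive (x≉0 j))))) ⟩
        - ζ * (inv (1# + u i * u j) * (x i * x j)) ∎
        where
        x⁻¹ᵢx⁻¹ⱼ≉0 = *-≉0 (inv-≉0 (x≉0 i)) (inv-≉0 (x≉0 j))

      admissible : ∀ {i j} → σ R inv (_÷_ R inv (x j) (x i)) ≉ 0# → σ R inv (ζ * (x i * x j)) ≉ 0# → Admissible i j
      admissible {i} {j} σ[xⱼ/xᵢ]≉0 σ[ζxᵢxⱼ]≉0 = x-y≉0⇒y-x≉0 uⱼ-uᵢ≉0 , 1+uᵢuⱼ≉0
        where
        uⱼ-uᵢ≉0 : u j - u i ≉ 0#
        uⱼ-uᵢ≉0 uⱼ-uᵢ≈0 = σ[xⱼ/xᵢ]≉0 (trans (σ-ratio i j) (trans (*-congʳ uⱼ-uᵢ≈0) (zeroˡ _)))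
        1+uᵢuⱼ≉0 : 1# + u i * u j ≉ 0#
        1+uᵢuⱼ≉0 1+uᵢuⱼ≈0 = σ[ζxᵢxⱼ]≉0 (trans (σ-ζxx i j) (trans (*-congˡ (trans (*-congʳ 1+uᵢuⱼ≈0) (zeroˡ _))) (zeroʳ ζ)))

      M-OO-offDiagonal : ∀ b {i j} → 1# + u i * u j ≉ 0# → M-OO R inv n x ζ b b i j ≈ K b * a i j
      M-OO-offDiagonal b {i} {j} 1+uᵢuⱼ≉0 = begin
        σ R inv (_÷_ R inv (x j) (x i)) * (b * b * inv (σ R inv (ζ * (x i * x j))) + b * b * inv (σ R inv (_÷_ R inv ζ (x i * x j))))
          ≈⟨ *-cong (σ-ratio i j) (+-cong (*-congˡ (inv-σ≈ (σ-ζxx i j))) (*-congˡ (inv-σ≈ (σ-ζ÷xx i j)))) ⟩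
        (u j - u i) * (x⁻¹ i * x⁻¹ j) * (b * b * W + b * b * W)
          ≈⟨ solve 7 (λ xᵢ xⱼ yᵢ yⱼ bb z I → (xⱼ :* xⱼ :- xᵢ :* xᵢ) :* (yᵢ :* yⱼ) :* (bb :* (:- z :* (I :* (xᵢ :* xⱼ))) :+ bb :* (:- z :* (I :* (xᵢ :* xⱼ))))
                 := (con (+ 1) :+ con (+ 1)) :* bb :* (:- z) :* ((con (+ 1) :* (xⱼ :* xⱼ) :- xᵢ :* xᵢ) :* I) :* ((xᵢ :* yᵢ) :* (xⱼ :* yⱼ)))
                 refl (x i) (x j) (x⁻¹ i) (x⁻¹ j) (b * b) ζ I ⟩
        K b * a i j * ((x i * x⁻¹ i) * (x j * x⁻¹ j))
          ≈⟨ *-congˡ (*-cong (inverseʳ _ (x≉0 i)) (inverseʳ _ (x≉0 j))) ⟩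
        K b * a i j * (1# * 1#)
          ≈⟨ trans (*-congˡ (*-identityˡ 1#)) (*-identityʳ _) ⟩
        K b * a i j ∎
        where
        I = inv (1# + u i * u j)
        W = - ζ * (I * (x i * x j))
        inv-σ≈ : ∀ {y} → y ≈ D i j → inv y ≈ W
        inv-σ≈ y≈D = trans (inv-cong (≉0-resp-≈ (sym y≈D) (D≉0 1+uᵢuⱼ≉0)) y≈D) (inv-D 1+uᵢuⱼ≉0)

      M-OO-diagonal : ∀ b i → M-OO R inv n x ζ b b i i ≈ K b * a i i
      M-OO-diagonal b i = begin
        (x i * x⁻¹ i - inv (x i * x⁻¹ i)) * Z
          ≈⟨ *-congʳ (+-cong (inverseʳ _ (x≉0 i)) (-‿cong (trans (inv-cong (≉0-resp-≈ (sym xᵢx⁻¹ᵢ≈1) 1≉0) xᵢx⁻¹ᵢ≈1) inv-1))) ⟩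
        (1# - 1#) * Z
          ≈⟨ solve 4 (λ Z k y I → (con (+ 1) :- con (+ 1)) :* Z := k :* ((con (+ 1) :* y :- y) :* I)) refl Z (K b) (u i) _ ⟩
        K b * a i i ∎
        where
        xᵢx⁻¹ᵢ≈1 = inverseʳ _ (x≉0 i)
        Z = b * b * inv (σ R inv (ζ * (x i * x i))) + b * b * inv (σ R inv (_÷_ R inv ζ (x i * x i)))

      M-OO≈K*a : ∀ b → (∀ i j → toℕ i ℕ.< toℕ j → Admissible i j) → ∀ i j → M-OO R inv n x ζ b b i j ≈ K b * a i j
      M-OO≈K*a b admissible i j with Fin.<-cmp i j
      ... | tri< i<j _ _ = M-OO-offDiagonal b (proj₂ (admissible i j i<j))
      ... | tri> _ _ j<i = M-OO-offDiagonal b (≉0-resp-≈ (+-congˡ (*-comm _ _)) (proj₂ (admissible j i j<i)))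
      ... | tri≈ _ ≡.refl _ = M-OO-diagonal b i

      Pf-M-OO : ∀ b → (∀ i j → toℕ i ℕ.< toℕ j → Admissible i j) →
        Pf R inv (2 ℕ.* n) (M-OO R inv n x ζ b b) ≈ K b ^ n * ∏< (2 ℕ.* n) a
      Pf-M-OO b admissible = begin
        Pf R inv (2 ℕ.* n) (M-OO R inv n x ζ b b)    ≈⟨ pf-cong (M-OO≈K*a b admissible) (2 ℕ.* n) (allFin _) ⟩
        Pf R inv (2 ℕ.* n) (λ i j → K b * a i j)      ≈⟨ pf-scale (K b) a (double n) (allFin _) ⟩
        K b ^ n * Pf R inv (2 ℕ.* n) a                ≈⟨ *-congˡ (pf≈∏< (double n) admissible) ⟩
        K b ^ n * ∏< (2 ℕ.* n) a                      ∎

      numerator denominator : Fin (2 ℕ.* n) → Fin (2 ℕ.* n) → Carrier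
      numerator i j = σ R inv (ζ * (x i * x j)) * σ R inv (_÷_ R inv ζ (x i * x j))
      denominator i j = σ R inv (_÷_ R inv (x j) (x i))

      numerator*a : ∀ {i j} → 1# + u i * u j ≉ 0# →
        numerator i j * a i j ≈ - 1# * ((1# + u i * u j) * ((x⁻¹ i * x⁻¹ j) * denominator i j))
      numerator*a {i} {j} 1+uᵢuⱼ≉0 = begin
        numerator i j * a i j
          ≈⟨ *-congʳ (*-cong (σ-ζxx i j) (σ-ζ÷xx i j)) ⟩
        D i j * D i j * ((1# * u j - u i) * I)
          ≈⟨ solve 6 (λ z uᵢ uⱼ yᵢ yⱼ I → let P = con (+ 1) :+ uᵢ :* uⱼ ; Y = yᵢ :* yⱼ in
                       z :* (P :* Y) :* (z :* (P :* Y)) :* ((con (+ 1) :* uⱼ :- uᵢ) :* I)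
                       := (z :* z) :* (P :* (Y :* ((uⱼ :- uᵢ) :* Y)) :* (P :* I)))
                     refl ζ (u i) (u j) (x⁻¹ i) (x⁻¹ j) I ⟩
        (ζ * ζ) * ((1# + u i * u j) * ((x⁻¹ i * x⁻¹ j) * ((u j - u i) * (x⁻¹ i * x⁻¹ j))) * ((1# + u i * u j) * I))
          ≈⟨ *-cong ζ²≈-1 (trans (*-congˡ (inverseʳ _ 1+uᵢuⱼ≉0)) (*-identityʳ _)) ⟩
        - 1# * ((1# + u i * u j) * ((x⁻¹ i * x⁻¹ j) * ((u j - u i) * (x⁻¹ i * x⁻¹ j))))
          ≈⟨ *-congˡ (*-congˡ (*-congˡ (σ-ratio i j))) ⟨
        - 1# * ((1# + u i * u j) * ((x⁻¹ i * x⁻¹ j) * denominator i j)) ∎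
        where
        I = inv (1# + u i * u j)

      F-OD*Pf : ∀ b → (∀ i j → toℕ i ℕ.< toℕ j → Admissible i j) → (∀ i j → toℕ i ℕ.< toℕ j → denominator i j ≉ 0#) →
        F-OD R inv n x ζ * Pf R inv (2 ℕ.* n) (M-OO R inv n x ζ b b)
          ≈ K b ^ n * ((- 1#) ^ #pairs (2 ℕ.* n) * (∏< (2 ℕ.* n) (λ i j → 1# + u i * u j) * ∏< (2 ℕ.* n) (λ i j → x⁻¹ i * x⁻¹ j)))
      F-OD*Pf b admissible den≉0 = begin
        prodPairs R inv m numerator * inv (prodPairs R inv m denominator) * Pf R inv m (M-OO R inv n x ζ b b)
          ≈⟨ *-cong (*-cong (prodPairs≈∏< m numerator) (inv-cong (≉0-resp-≈ (sym (prodPairs≈∏< m denominator)) Π-den≉0) (prodPairs≈∏< m denominator)))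
                    (Pf-M-OO b admissible) ⟩
        Π-num * inv Π-den * (K b ^ n * ∏< m a)
          ≈⟨ solve 4 (λ N iΔ Kⁿ A → N :* iΔ :* (Kⁿ :* A) := Kⁿ :* (N :* A :* iΔ)) refl Π-num (inv Π-den) (K b ^ n) (∏< m a) ⟩
        K b ^ n * (Π-num * ∏< m a * inv Π-den)
          ≈⟨ *-congˡ (*-congʳ (begin
               Π-num * ∏< m a
                 ≈⟨ ∏<-distrib-* m numerator a ⟨
               ∏< m (λ i j → numerator i j * a i j)
                 ≈⟨ ∏<-cong m (λ i j i<j → numerator*a (proj₂ (admissible i j i<j))) ⟩
               ∏< m (λ i j → - 1# * (P i j * (Y i j * denominator i j)))
                 ≈⟨ ∏<-scale m (- 1#) (λ i j → P i j * (Y i j * denominator i j)) ⟩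
               (- 1#) ^ #pairs m * ∏< m (λ i j → P i j * (Y i j * denominator i j))
                 ≈⟨ *-congˡ (trans (∏<-distrib-* m P _) (*-congˡ (∏<-distrib-* m Y denominator))) ⟩
               (- 1#) ^ #pairs m * (∏< m P * (∏< m Y * Π-den)) ∎)) ⟩
        K b ^ n * ((- 1#) ^ #pairs m * (∏< m P * (∏< m Y * Π-den)) * inv Π-den)
          ≈⟨ *-congˡ (solve 5 (λ s A B Δ iΔ → s :* (A :* (B :* Δ)) :* iΔ := s :* (A :* B) :* (Δ :* iΔ))
                             refl ((- 1#) ^ #pairs m) (∏< m P) (∏< m Y) Π-den (inv Π-den)) ⟩
        K b ^ n * ((- 1#) ^ #pairs m * (∏< m P * ∏< m Y) * (Π-den * inv Π-den))
          ≈⟨ *-congˡ (trans (*-congˡ (inverseʳ _ Π-den≉0)) (*-identityʳ _)) ⟩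
        K b ^ n * ((- 1#) ^ #pairs m * (∏< m P * ∏< m Y)) ∎
        where
        m = 2 ℕ.* n
        Π-num = ∏< m numerator
        Π-den = ∏< m denominator
        Π-den≉0 = ∏<-≉0 m den≉0
        P Y : Fin m → Fin m → Carrier
        P i j = 1# + u i * u j
        Y i j = x⁻¹ i * x⁻¹ j

      A2-OO≈RHS : ∀ {b} → two R inv ≉ 0# → b ≉ 0# →
        (∀ i j → toℕ i ℕ.< toℕ j → Admissible i j × denominator i j ≉ 0#) → A2-OO R inv n x ζ b b ≈ RHS R inv n x
      A2-OO≈RHS {b} 2≉0 b≉0 hyp = begin
        b⁻ᵐ * (σ⁻ᴺ * (F-OD R inv n x ζ * Pf R inv m (M-OO R inv n x ζ b b)))
          ≈⟨ *-congˡ (*-congˡ (F-OD*Pf b (λ i j → proj₁ ∘ hyp i j) (λ i j → proj₂ ∘ hyp i j))) ⟩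
        b⁻ᵐ * (σ⁻ᴺ * (K b ^ n * ((- 1#) ^ #pairs m * (∏< m P * ∏< m Y))))
          ≈⟨ solve 6 (λ B S Kⁿ s Π Υ → B :* (S :* (Kⁿ :* (s :* (Π :* Υ)))) := B :* (S :* (Kⁿ :* s)) :* (Υ :* Π))
                     refl b⁻ᵐ σ⁻ᴺ (K b ^ n) ((- 1#) ^ #pairs m) (∏< m P) (∏< m Y) ⟩
        b⁻ᵐ * (σ⁻ᴺ * (K b ^ n * (- 1#) ^ #pairs m)) * (∏< m Y * ∏< m P)
          ≈⟨ *-cong (scalars n 2≉0 b≉0) (*-cong (∏<-inverses m x) (sym (prodPairs≈∏< m P))) ⟩
        RHS R inv n x ∎
        where
        m = 2 ℕ.* n
        b⁻ᵐ = powℤ R inv b (ℤ.- (+ m))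
        σ⁻ᴺ = powℤ R inv (σ R inv ζ) (ℤ.- (+ (m ℕ.* n)) ℤ.+ (+ n))
        P Y : Fin m → Fin m → Carrier
        P i j = 1# + u i * u j
        Y i j = x⁻¹ i * x⁻¹ j

open import Data.Nat using (_<_; _≤_; _*_)

theorem2p4 : ∀ {c ℓ} (R : CommutativeRing c ℓ) →
    let open CommutativeRing R renaming (_*_ to _·_) in
    (inv : Carrier → Carrier) →
    (∀ y → ¬ (y ≈ 0#) → y · inv y ≈ 1#) →
    (∀ (k : ℕ) → ¬ (sumFin R inv (suc k) (λ _ → 1#) ≈ 0#)) →
    (ζ : Carrier) → ζ · ζ ≈ - 1# →
    (n : ℕ) → 1 ≤ n →
    (x : Fin (2 * n) → Carrier) →
    (b : Carrier) → ¬ (b ≈ 0#) →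
    (∀ i → ¬ (x i ≈ 0#)) →
    (∀ i j → toℕ i < toℕ j →
      ¬ (σ R inv (_÷_ R inv (x j) (x i)) ≈ 0#)
      × ¬ (σ R inv (ζ · (x i · x j)) ≈ 0#)
      × ¬ (σ R inv (_÷_ R inv ζ (x i · x j)) ≈ 0#)) →
    A2-OO R inv n x ζ b b ≈ RHS R inv n x
theorem2p4 R inv inverseʳ ∑1≉0 ζ ζ²≈-1 n _ x b b≉0 x≉0 σ≉0 =
  A2-OO≈RHS {n} x x≉0 2≉0 b≉0 λ i j i<j →
    let σ[xⱼ/xᵢ]≉0 , σ[ζxᵢxⱼ]≉0 , _ = σ≉0 i j i<j in admissible {n} x x≉0 σ[xⱼ/xᵢ]≉0 σ[ζxᵢxⱼ]≉0 , σ[xⱼ/xᵢ]≉0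
  where
  open CommutativeRing R

  1≉0 : 1# ≉ 0#
  1≉0 1≈0 = ∑1≉0 0 (trans (+-identityʳ 1#) 1≈0)

  2≉0 : two R inv ≉ 0#
  2≉0 2≈0 = ∑1≉0 1 (trans (+-congˡ (+-identityʳ 1#)) 2≈0)

  open Field R inv inverseʳ 1≉0
  open Entries ζ ζ²≈-1
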